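{- For every pair of integers $m\ge n\ge 2$, $\operatorname{fdom}(K_{m,n}) = 1+n\left(1-\frac{1}{m}\right)$.
   Context: $N[v]$ denotes the closed neighbourhood of $v$. For integers $0<q\le p$, a dominating $(p:q)$-colouring of a graph $G$ is a map $\phi\colon V(G)\to\binom{[p]}{q}$ such that $\bigcup_{u\in N[v]}\phi(u)=[p]$ for every $v\in V(G)$. The fractional domatic number $\operatorname{fdom}(G)$ is the maximum of $p/q$ over all dominating $(p:q)$-colourings of $G$; equivalently, it is the optimum of the LP maximising $\sum_D x_D$ over nonnegative weights on dominating sets $D$ subject to $\sum_{D\ni v}x_D\le 1$ for every vertex $v$. -}

module Defs where

open import Data.Nat using (ℕ; zero; suc; _<_; _≤_; NonZero; >-nonZero; s≤s; z≤n; _+_)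
open import Data.Empty using (⊥)
open import Data.Nat.Properties using (≤-trans)
open import Data.Fin using (Fin; toℕ)
open import Data.Fin.Subset using (Subset; _∈_; ∣_∣)
open import Data.Product using (Σ; ∃; ∃-syntax; _×_; _,_)
open import Data.Sum using (_⊎_)
open import Data.Integer using (+_)
open import Data.Rational using (ℚ; _/_) renaming (_≤_ to _≤ℚ_)
open import Relation.Binary.PropositionalEquality using (_≡_)

record Graph : Set₁ where
  field
    V     : ℕ
    Adj   : Fin V → Fin V → Set
    sym   : ∀ {u v} → Adj u v → Adj v u
    irref : ∀ {v} → Adj v v → ⊥
open Graph public
  hiding (sym)

_∈N[_]_ : (G : Graph) → Fin (V G) → Fin (V G) → Set
_∈N[_]_ G u v = (u ≡ v) ⊎ Adj G v u

record Colouring (G : Graph) (p q : ℕ) : Set where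
  field
    φ    : Fin (V G) → Subset p
    size : ∀ v → ∣ φ v ∣ ≡ q

Dominating : {G : Graph} {p q : ℕ} → Colouring G p q → Set
Dominating {G} {p} c =
  ∀ (v : Fin (V G)) (i : Fin p) → ∃[ u ] (G ∈N[ u ] v) × (i ∈ Colouring.φ c u)

DomColouring : Graph → ℕ → ℕ → Set
DomColouring G p q = Σ (Colouring G p q) Dominating

ratio : (p q : ℕ) → 0 < q → ℚ
ratio p q h = (+ p / q) {{>-nonZero h}}

IsFdom : Graph → ℚ → Set
IsFdom G r =
  (∃[ p ] ∃[ q ] Σ (0 < q) λ q>0 → (q ≤ p) × DomColouring G p q × (ratio p q q>0 ≡ r))
  × (∀ p q (q>0 : 0 < q) → q ≤ p → DomColouring G p q → ratio p q q>0 ≤ℚ r)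

-- complete bipartite graph K_{m,n}: vertices 0..m-1 (part A) and m..m+n-1 (part B)
KAdj : (m n : ℕ) → Fin (m + n) → Fin (m + n) → Set
KAdj m n u v = ((toℕ u < m) × (m ≤ toℕ v)) ⊎ ((m ≤ toℕ u) × (toℕ v < m))

private
  open import Data.Sum using (inj₁; inj₂)
  open import Data.Nat.Properties using (<-irrefl; ≤-<-trans)
  open import Relation.Binary.PropositionalEquality using (refl)
  KAdj-sym : ∀ {m n u v} → KAdj m n u v → KAdj m n v u
  KAdj-sym (inj₁ (a , b)) = inj₂ (b , a)
  KAdj-sym (inj₂ (a , b)) = inj₁ (b , a)
  KAdj-irr : ∀ {m n v} → KAdj m n v v → ⊥
  KAdj-irr (inj₁ (a , b)) = <-irrefl refl (≤-<-trans b a)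
  KAdj-irr (inj₂ (a , b)) = <-irrefl refl (≤-<-trans a b)

K : ℕ → ℕ → Graph
K m n = record { V = m + n ; Adj = KAdj m n ; sym = KAdj-sym ; irref = KAdj-irr }

pos : ∀ {m n} → 2 ≤ n → n ≤ m → 0 < m
pos h k = ≤-trans (s≤s z≤n) (≤-trans h k)

-- For a colour i of a dominating (p:q)-colouring of K_{m,n}, let a_i and b_i be
-- the numbers of left and right vertices carrying i. A left vertex without i
-- must see i on the right side, so b_i = 0 forces a_i = m, and symmetrically
-- a_i = 0 forces b_i = n; as m, n ≥ 2 this gives m ≤ a_i + (m-1) b_i in every
-- case. Summing over the p colours counts every colour class once:
-- p m ≤ m q + (m-1) n q, i.e. p/q ≤ 1 + n(1 - 1/m).
-- The bound is attained with c = m - n common colours and n m colours (j, k):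
-- left vertex k gets the common colours and every (j, k), right vertex j gets
-- every (j, k). Each vertex then carries m of the c + n m = m + (m-1) n colours.

module Submission where

open import Defs
open import Data.Nat using (ℕ; _≤_; s≤s; z≤n)
import Data.Nat as ℕ
open import Data.Nat.Properties using (≤-pred; ≤-trans; m≤m+n; m∸n+n≡m)
open import Data.Product using (_,_)
open import Relation.Binary.PropositionalEquality using (_≡_; cong; trans; sym; subst)

module Counting where

  open import Data.Nat using (suc; zero; _+_; _*_)
  open import Data.Nat.Properties
    using (+-*-semiring; +-assoc; +-mono-≤; *-identityʳ; *-zeroʳ; m+n≡0⇒m≡0; m+n≡0⇒n≡0)
  open import Data.Bool using (Bool; true; false)
  open import Data.Fin using (Fin; zero; suc; _↑ˡ_; _↑ʳ_; combine)
  open import Data.Fin.Properties using (_≟_)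
  open import Data.Fin.Subset using (Subset; ∣_∣; inside; outside)
  open import Data.Fin.Subset.Properties using (_∈?_)
  open import Data.Vec using (_∷_; []; tabulate)
  open import Function using (_∘_)
  open import Relation.Nullary using (¬_; Dec; does; no)
  open import Relation.Nullary.Decidable using (dec-true)
  open import Relation.Unary using (Pred; Decidable)
  open import Relation.Binary.PropositionalEquality

  open import Algebra.Properties.Semiring.Sum +-*-semiring public
    using (sum; sum-syntax; sum-cong-≗; ∑-comm; ∑-distrib-+; *-distribˡ-sum)

  indicator : Bool → ℕ
  indicator true  = 1
  indicator false = 0

  ∑-const : ∀ n c → ∑[ i < n ] c ≡ n * c
  ∑-const zero    c = refl
  ∑-const (suc n) c = cong (c +_) (∑-const n c)

  ∑-mono-≤ : ∀ {n} {f g : Fin n → ℕ} → (∀ i → f i ≤ g i) → sum f ≤ sum g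
  ∑-mono-≤ {zero}  f≤g = z≤n
  ∑-mono-≤ {suc n} f≤g = +-mono-≤ (f≤g zero) (∑-mono-≤ (f≤g ∘ suc))

  ∑-↑ : ∀ a b (f : Fin (a + b) → ℕ) →
        ∑[ t < a + b ] f t ≡ ∑[ i < a ] f (i ↑ˡ b) + ∑[ j < b ] f (a ↑ʳ j)
  ∑-↑ zero    b f = refl
  ∑-↑ (suc a) b f =
    trans (cong (f zero +_) (∑-↑ a b (f ∘ suc))) (sym (+-assoc (f zero) _ _))

  ∑-combine : ∀ a b (f : Fin (a * b) → ℕ) →
              ∑[ t < a * b ] f t ≡ ∑[ i < a ] ∑[ j < b ] f (combine i j)
  ∑-combine zero    b f = refl
  ∑-combine (suc a) b f =
    trans (∑-↑ b (a * b) f) (cong (∑[ j < b ] f (j ↑ˡ a * b) +_) (∑-combine a b (f ∘ (b ↑ʳ_))))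

  ∑≡0⇒≡0 : ∀ {n} (f : Fin n → ℕ) → sum f ≡ 0 → ∀ i → f i ≡ 0
  ∑≡0⇒≡0 f ∑f≡0 zero    = m+n≡0⇒m≡0 (f zero) ∑f≡0
  ∑≡0⇒≡0 f ∑f≡0 (suc i) = ∑≡0⇒≡0 (f ∘ suc) (m+n≡0⇒n≡0 (f zero) ∑f≡0) i

  indicator-yes : ∀ {p} {P : Set p} (P? : Dec P) → P → indicator (does P?) ≡ 1
  indicator-yes P? p = cong indicator (dec-true P? p)

  ∑-indicator-all : ∀ {n p} {P : Pred (Fin n) p} (P? : Decidable P) →
                    (∀ i → P i) → ∑[ i < n ] indicator (does (P? i)) ≡ n
  ∑-indicator-all {n} P? all = begin
    ∑[ i < n ] indicator (does (P? i))  ≡⟨ sum-cong-≗ (λ i → indicator-yes (P? i) (all i)) ⟩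
    ∑[ i < n ] 1                        ≡⟨ ∑-const n 1 ⟩
    n * 1                               ≡⟨ *-identityʳ n ⟩
    n                                   ∎
    where open ≡-Reasoning

  ∑-indicator≡0 : ∀ {n p} {P : Pred (Fin n) p} (P? : Decidable P) →
                  ∑[ i < n ] indicator (does (P? i)) ≡ 0 → ∀ i → ¬ P i
  ∑-indicator≡0 P? ∑≡0 i Pi with P? i | ∑≡0⇒≡0 (λ i → indicator (does (P? i))) ∑≡0 i
  ... | no ¬Pi | _ = ¬Pi Pi

  ∑-δ : ∀ n (k : Fin n) → ∑[ i < n ] indicator (does (i ≟ k)) ≡ 1
  ∑-δ (suc n) zero    = cong suc (trans (∑-const n 0) (*-zeroʳ n))
  ∑-δ (suc n) (suc k) = ∑-δ n k

  ∣p∣≡∑∈? : ∀ {n} (p : Subset n) → ∣ p ∣ ≡ ∑[ i < n ] indicator (does (i ∈? p))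
  ∣p∣≡∑∈? []            = refl
  ∣p∣≡∑∈? (inside  ∷ p) = cong suc (∣p∣≡∑∈? p)
  ∣p∣≡∑∈? (outside ∷ p) = ∣p∣≡∑∈? p

  ∣tabulate∣ : ∀ {n} (f : Fin n → Bool) → ∣ tabulate f ∣ ≡ ∑[ i < n ] indicator (f i)
  ∣tabulate∣ {zero}  f = refl
  ∣tabulate∣ {suc n} f with f zero
  ... | true  = cong suc (∣tabulate∣ (f ∘ suc))
  ... | false = ∣tabulate∣ (f ∘ suc)

  double-count : ∀ {N p q} (φ : Fin N → Subset p) → (∀ u → ∣ φ u ∣ ≡ q) →
                 ∑[ i < p ] ∑[ u < N ] indicator (does (i ∈? φ u)) ≡ N * q
  double-count {N} {p} {q} φ ∣φ∣≡q = begin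
    ∑[ i < p ] ∑[ u < N ] indicator (does (i ∈? φ u))  ≡⟨ ∑-comm (λ u i → indicator (does (i ∈? φ u))) ⟨
    ∑[ u < N ] ∑[ i < p ] indicator (does (i ∈? φ u))  ≡⟨ sum-cong-≗ (λ u → trans (sym (∣p∣≡∑∈? (φ u))) (∣φ∣≡q u)) ⟩
    ∑[ u < N ] q                                       ≡⟨ ∑-const N q ⟩
    N * q                                              ∎
    where open ≡-Reasoning

module FinSplit where

  open import Data.Nat using (_+_)
  open import Data.Fin using (Fin; splitAt; _↑ˡ_; _↑ʳ_)
  open import Data.Fin.Properties using (splitAt⁻¹-↑ˡ; splitAt⁻¹-↑ʳ)
  open import Data.Sum using (inj₁; inj₂)
  open import Relation.Binary.PropositionalEquality using (subst)

  data SumView (a b : ℕ) : Fin (a + b) → Set where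
    left  : (i : Fin a) → SumView a b (i ↑ˡ b)
    right : (j : Fin b) → SumView a b (a ↑ʳ j)

  sumView : ∀ a b t → SumView a b t
  sumView a b t with splitAt a t in eq
  ... | inj₁ i = subst (SumView a b) (splitAt⁻¹-↑ˡ eq) (left i)
  ... | inj₂ j = subst (SumView a b) (splitAt⁻¹-↑ʳ eq) (right j)

module CompleteBipartite (m n : ℕ) where

  open import Data.Nat using (_<_)
  open import Data.Nat.Properties using (m≤m+n; <⇒≱)
  open import Data.Fin using (Fin; toℕ; _↑ˡ_; _↑ʳ_)
  open import Data.Fin.Properties using (toℕ-↑ˡ; toℕ-↑ʳ; toℕ<n)
  open import Data.Fin.Subset using (_∈_; _∉_)
  open import Data.Product using (_,_; proj₁; proj₂)
  open import Data.Sum using (inj₁; inj₂)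
  open import Data.Empty using (⊥-elim)
  open import Relation.Nullary using (¬_)
  open import Relation.Binary.PropositionalEquality
  open FinSplit

  toℕ-↑ˡ< : ∀ (k : Fin m) → toℕ (k ↑ˡ n) < m
  toℕ-↑ˡ< k = subst (_< m) (sym (toℕ-↑ˡ k n)) (toℕ<n k)

  ≤toℕ-↑ʳ : ∀ (j : Fin n) → m ≤ toℕ (m ↑ʳ j)
  ≤toℕ-↑ʳ j = subst (m ≤_) (sym (toℕ-↑ʳ m j)) (m≤m+n m (toℕ j))

  ↑ˡ-adj-↑ʳ : ∀ (k : Fin m) (j : Fin n) → KAdj m n (k ↑ˡ n) (m ↑ʳ j)
  ↑ˡ-adj-↑ʳ k j = inj₁ (toℕ-↑ˡ< k , ≤toℕ-↑ʳ j)

  ↑ʳ-adj-↑ˡ : ∀ (j : Fin n) (k : Fin m) → KAdj m n (m ↑ʳ j) (k ↑ˡ n)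
  ↑ʳ-adj-↑ˡ j k = inj₂ (≤toℕ-↑ʳ j , toℕ-↑ˡ< k)

  ¬↑ˡ-adj-↑ˡ : ∀ (k k′ : Fin m) → ¬ KAdj m n (k ↑ˡ n) (k′ ↑ˡ n)
  ¬↑ˡ-adj-↑ˡ k k′ (inj₁ (_ , m≤k′)) = <⇒≱ (toℕ-↑ˡ< k′) m≤k′
  ¬↑ˡ-adj-↑ˡ k k′ (inj₂ (m≤k , _))  = <⇒≱ (toℕ-↑ˡ< k) m≤k

  ¬↑ʳ-adj-↑ʳ : ∀ (j j′ : Fin n) → ¬ KAdj m n (m ↑ʳ j) (m ↑ʳ j′)
  ¬↑ʳ-adj-↑ʳ j j′ (inj₁ (j<m , _)) = <⇒≱ j<m (≤toℕ-↑ʳ j)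
  ¬↑ʳ-adj-↑ʳ j j′ (inj₂ (_ , j′<m)) = <⇒≱ j′<m (≤toℕ-↑ʳ j′)

  module _ {p q} (D : DomColouring (K m n) p q) where

    open Colouring (proj₁ D)

    ∉right⇒∈left : ∀ {i} → (∀ j → i ∉ φ (m ↑ʳ j)) → ∀ k → i ∈ φ (k ↑ˡ n)
    ∉right⇒∈left {i} i∉right k with proj₂ D (k ↑ˡ n) i
    ... | u , u∈N , i∈φu with sumView m n u
    ...   | right j = ⊥-elim (i∉right j i∈φu)
    ...   | left k′ with u∈N
    ...     | inj₁ k′≡k = subst (λ v → i ∈ φ v) k′≡k i∈φu
    ...     | inj₂ adj  = ⊥-elim (¬↑ˡ-adj-↑ˡ k k′ adj)

    ∉left⇒∈right : ∀ {i} → (∀ k → i ∉ φ (k ↑ˡ n)) → ∀ j → i ∈ φ (m ↑ʳ j)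
    ∉left⇒∈right {i} i∉left j with proj₂ D (m ↑ʳ j) i
    ... | u , u∈N , i∈φu with sumView m n u
    ...   | left k = ⊥-elim (i∉left k i∈φu)
    ...   | right j′ with u∈N
    ...     | inj₁ j′≡j = subst (λ v → i ∈ φ v) j′≡j i∈φu
    ...     | inj₂ adj  = ⊥-elim (¬↑ʳ-adj-↑ʳ j j′ adj)

module UpperBound where

  open import Data.Nat using (suc; zero; _+_; _*_)
  open import Data.Nat.Properties
  open import Data.Fin using (Fin; _↑ˡ_; _↑ʳ_)
  open import Data.Fin.Subset.Properties using (_∈?_)
  open import Data.Product using (proj₁)
  open import Relation.Nullary using (does)
  open import Relation.Binary.PropositionalEquality
  open Counting

  colour-count-bound : ∀ {m′ n a b} → 1 ≤ m′ → 2 ≤ n →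
                       (b ≡ 0 → a ≡ suc m′) → (a ≡ 0 → b ≡ n) → suc m′ ≤ a + m′ * b
  colour-count-bound {m′} {a = a} {zero} _ _ b≡0⇒a≡m _ = begin
    suc m′      ≡⟨ b≡0⇒a≡m refl ⟨
    a           ≤⟨ m≤m+n a _ ⟩
    a + m′ * 0  ∎
    where open ≤-Reasoning
  colour-count-bound {m′} {n} {zero} {b@(suc _)} 1≤m′ 2≤n _ a≡0⇒b≡n = begin
    suc m′   ≤⟨ +-monoˡ-≤ m′ 1≤m′ ⟩
    m′ + m′  ≡⟨ trans (*-suc m′ 1) (cong (m′ +_) (*-identityʳ m′)) ⟨
    m′ * 2   ≤⟨ *-monoʳ-≤ m′ 2≤n ⟩
    m′ * n   ≡⟨ cong (m′ *_) (a≡0⇒b≡n refl) ⟨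
    m′ * b   ∎
    where open ≤-Reasoning
  colour-count-bound {m′} {a = suc a} {b@(suc _)} _ _ _ _ =
    s≤s (≤-trans (m≤m*n m′ b) (m≤n+m (m′ * b) a))

  module _ {m′ n p q} (1≤m′ : 1 ≤ m′) (2≤n : 2 ≤ n) (D : DomColouring (K (suc m′) n) p q) where

    open CompleteBipartite (suc m′) n
    open Colouring (proj₁ D)

    m : ℕ
    m = suc m′

    left-count right-count : Fin p → ℕ
    left-count  i = ∑[ k < m ] indicator (does (i ∈? φ (k ↑ˡ n)))
    right-count i = ∑[ j < n ] indicator (does (i ∈? φ (m ↑ʳ j)))

    colour-bound : ∀ i → m ≤ left-count i + m′ * right-count i
    colour-bound i = colour-count-bound 1≤m′ 2≤n
      (λ right≡0 → ∑-indicator-all (λ k → i ∈? φ (k ↑ˡ n))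
        (∉right⇒∈left D (∑-indicator≡0 (λ j → i ∈? φ (m ↑ʳ j)) right≡0)))
      (λ left≡0 → ∑-indicator-all (λ j → i ∈? φ (m ↑ʳ j))
        (∉left⇒∈right D (∑-indicator≡0 (λ k → i ∈? φ (k ↑ˡ n)) left≡0)))

    domColouring-bound : p * m ≤ (m + m′ * n) * q
    domColouring-bound = begin
      p * m
        ≡⟨ ∑-const p m ⟨
      ∑[ i < p ] m
        ≤⟨ ∑-mono-≤ colour-bound ⟩
      ∑[ i < p ] (left-count i + m′ * right-count i)
        ≡⟨ ∑-distrib-+ left-count _ ⟩
      sum left-count + ∑[ i < p ] (m′ * right-count i)
        ≡⟨ cong (sum left-count +_) (*-distribˡ-sum m′ right-count) ⟨
      sum left-count + m′ * sum right-count
        ≡⟨ cong₂ (λ a b → a + m′ * b) (double-count (λ k → φ (k ↑ˡ n)) (λ k → size (k ↑ˡ n)))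
                                      (double-count (λ j → φ (m ↑ʳ j)) (λ j → size (m ↑ʳ j))) ⟩
      m * q + m′ * (n * q)
        ≡⟨ cong (m * q +_) (*-assoc m′ n q) ⟨
      m * q + m′ * n * q
        ≡⟨ *-distribʳ-+ q m (m′ * n) ⟨
      (m + m′ * n) * q
        ∎
      where open ≤-Reasoning

module Construction (m′ n c : ℕ) (c+n≡m : c ℕ.+ n ≡ ℕ.suc m′) where

  open import Data.Nat using (suc; _+_; _*_)
  open import Data.Nat.Properties using (+-assoc; *-suc; *-comm; *-identityʳ; *-zeroʳ)
  open import Data.Bool using (Bool; true; false)
  open import Data.Fin using (Fin; zero; splitAt; _↑ˡ_; _↑ʳ_; remQuot; combine)
  open import Data.Fin.Properties using (_≟_; splitAt-↑ˡ; splitAt-↑ʳ; remQuot-combine)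
  open import Data.Fin.Subset using (Subset; _∈_)
  open import Data.Vec using (tabulate)
  open import Data.Vec.Properties using (lookup⇒[]=; lookup∘tabulate)
  open import Data.Product using (_×_; _,_; proj₁; proj₂)
  open import Data.Sum using (_⊎_; inj₁; inj₂; map₂)
  open import Function using (_∘_)
  open import Relation.Nullary using (does)
  open import Relation.Nullary.Decidable using (dec-true)
  open import Relation.Binary.PropositionalEquality
  open Counting
  open FinSplit
  open CompleteBipartite (suc m′) n

  m : ℕ
  m = suc m′

  Palette : Set
  Palette = Fin c ⊎ (Fin n × Fin m)

  palette : Fin (c + n * m) → Palette
  palette i = map₂ (remQuot m) (splitAt c i)

  palette-↑ˡ : ∀ x → palette (x ↑ˡ n * m) ≡ inj₁ x
  palette-↑ˡ x = cong (map₂ (remQuot m)) (splitAt-↑ˡ c x (n * m))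

  palette-↑ʳ : ∀ t → palette (c ↑ʳ t) ≡ inj₂ (remQuot m t)
  palette-↑ʳ t = cong (map₂ (remQuot m)) (splitAt-↑ʳ c (n * m) t)

  ∑-palette : (f : Palette → ℕ) →
              ∑[ i < c + n * m ] f (palette i) ≡ ∑[ x < c ] f (inj₁ x) + ∑[ j < n ] ∑[ k < m ] f (inj₂ (j , k))
  ∑-palette f = begin
    ∑[ i < c + n * m ] f (palette i)
      ≡⟨ ∑-↑ c (n * m) (f ∘ palette) ⟩
    ∑[ x < c ] f (palette (x ↑ˡ n * m)) + ∑[ t < n * m ] f (palette (c ↑ʳ t))
      ≡⟨ cong₂ _+_ (sum-cong-≗ (cong f ∘ palette-↑ˡ)) (sum-cong-≗ (cong f ∘ palette-↑ʳ)) ⟩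
    ∑[ x < c ] f (inj₁ x) + ∑[ t < n * m ] f (inj₂ (remQuot m t))
      ≡⟨ cong (∑[ x < c ] f (inj₁ x) +_) (∑-combine n m (f ∘ inj₂ ∘ remQuot m)) ⟩
    ∑[ x < c ] f (inj₁ x) + ∑[ j < n ] ∑[ k < m ] f (inj₂ (remQuot m (combine j k)))
      ≡⟨ cong (∑[ x < c ] f (inj₁ x) +_)
           (sum-cong-≗ λ j → sum-cong-≗ λ k → cong (f ∘ inj₂) (remQuot-combine j k)) ⟩
    ∑[ x < c ] f (inj₁ x) + ∑[ j < n ] ∑[ k < m ] f (inj₂ (j , k))
      ∎
    where open ≡-Reasoning

  carries : Fin m ⊎ Fin n → Palette → Bool
  carries (inj₁ k) (inj₁ _)        = true
  carries (inj₁ k) (inj₂ (_ , k′)) = does (k′ ≟ k)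
  carries (inj₂ j) (inj₁ _)        = false
  carries (inj₂ j) (inj₂ (j′ , _)) = does (j′ ≟ j)

  ∑-carries : ∀ s → ∑[ i < c + n * m ] indicator (carries s (palette i)) ≡ m
  ∑-carries s = trans (∑-palette (indicator ∘ carries s)) (split-count s)
    where
    open ≡-Reasoning
    split-count : ∀ s → ∑[ x < c ] indicator (carries s (inj₁ x))
                  + ∑[ j < n ] ∑[ k < m ] indicator (carries s (inj₂ (j , k))) ≡ m
    split-count (inj₁ k) = begin
      ∑[ x < c ] 1 + ∑[ j < n ] ∑[ k′ < m ] indicator (does (k′ ≟ k))
        ≡⟨ cong₂ _+_ (∑-const c 1) (sum-cong-≗ {n} (λ _ → ∑-δ m k)) ⟩
      c * 1 + ∑[ j < n ] 1
        ≡⟨ cong₂ _+_ (*-identityʳ c) (trans (∑-const n 1) (*-identityʳ n)) ⟩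
      c + n
        ≡⟨ c+n≡m ⟩
      m ∎
    split-count (inj₂ j) = begin
      ∑[ x < c ] 0 + ∑[ j′ < n ] ∑[ k < m ] indicator (does (j′ ≟ j))
        ≡⟨ cong₂ _+_ (trans (∑-const c 0) (*-zeroʳ c)) (sum-cong-≗ {n} (λ j′ → ∑-const m _)) ⟩
      ∑[ j′ < n ] (m * indicator (does (j′ ≟ j)))
        ≡⟨ *-distribˡ-sum m (λ j′ → indicator (does (j′ ≟ j))) ⟨
      m * ∑[ j′ < n ] indicator (does (j′ ≟ j))
        ≡⟨ cong (m *_) (∑-δ n j) ⟩
      m * 1
        ≡⟨ *-identityʳ m ⟩
      m ∎

  φ : Fin (m + n) → Subset (c + n * m)
  φ u = tabulate (λ i → carries (splitAt m u) (palette i))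

  colouring : Colouring (K m n) (c + n * m) m
  colouring = record
    { φ    = φ
    ; size = λ u → trans (∣tabulate∣ {c + n * m} _) (∑-carries (splitAt m u))
    }

  carried : ∀ u {i s x} → splitAt m u ≡ s → palette i ≡ x → carries s x ≡ true → i ∈ φ u
  carried u {i} refl refl carries≡true =
    lookup⇒[]= i (φ u) (trans (lookup∘tabulate _ i) carries≡true)

  dominating : Dominating colouring
  dominating v i with sumView m n v | sumView c (n * m) i
  ... | left k  | left x  = k ↑ˡ n , inj₁ refl , carried (k ↑ˡ n) (splitAt-↑ˡ m k n) (palette-↑ˡ x) refl
  ... | left k  | right t = m ↑ʳ j , inj₂ (↑ˡ-adj-↑ʳ k j) ,
                            carried (m ↑ʳ j) (splitAt-↑ʳ m n j) (palette-↑ʳ t) (dec-true (j ≟ j) refl)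
    where j = proj₁ (remQuot {n} m t)
  ... | right j | left x  = zero ↑ˡ n , inj₂ (↑ʳ-adj-↑ˡ j zero) ,
                            carried (zero ↑ˡ n) (splitAt-↑ˡ m zero n) (palette-↑ˡ x) refl
  ... | right j | right t = k ↑ˡ n , inj₂ (↑ʳ-adj-↑ˡ j k) ,
                            carried (k ↑ˡ n) (splitAt-↑ˡ m k n) (palette-↑ʳ t) (dec-true (k ≟ k) refl)
    where k = proj₂ (remQuot {n} m t)

  domColouring : DomColouring (K m n) (c + n * m) m
  domColouring = colouring , dominating

  #colours : c + n * m ≡ m + m′ * n
  #colours = begin
    c + n * m         ≡⟨ cong (c +_) (*-suc n m′) ⟩
    c + (n + n * m′)  ≡⟨ +-assoc c n (n * m′) ⟨
    c + n + n * m′    ≡⟨ cong₂ _+_ c+n≡m (*-comm n m′) ⟩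
    m + m′ * n        ∎
    where open ≡-Reasoning

open import Data.Rational using (1ℚ; _+_; _*_; _-_) renaming (_≤_ to _≤ℚ_)
open import Data.Integer using (+_)

module RatioArithmetic where

  open import Data.Nat using (suc; _<_)
  import Data.Integer as ℤ
  import Data.Integer.Properties as ℤ
  open import Data.Rational using (-_; toℚᵘ)
  open import Data.Rational.Properties
    using (toℚᵘ-fromℚᵘ; toℚᵘ-cancel-≤; toℚᵘ-injective; toℚᵘ-homo-+; toℚᵘ-homo-*; toℚᵘ-homo‿-)
  open import Data.Rational.Unnormalised as ℚᵘ using (mkℚᵘ; 1ℚᵘ; _≃_; *≤*; *≡*)
  import Data.Rational.Unnormalised.Properties as ℚᵘ
  open import Data.List using (_∷_; [])
  open import Relation.Binary.PropositionalEquality using (cong; subst₂)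
  import Data.Nat.Tactic.RingSolver as ℕ-Solver

  toℚᵘ-ratio : ∀ p q → toℚᵘ (ratio p (suc q) (s≤s z≤n)) ≃ mkℚᵘ (+ p) q
  toℚᵘ-ratio p q = toℚᵘ-fromℚᵘ (mkℚᵘ (+ p) q)

  ratio-mono-≤ : ∀ {p q c d} (q>0 : 0 < q) (d>0 : 0 < d) →
                 p ℕ.* d ≤ c ℕ.* q → ratio p q q>0 ≤ℚ ratio c d d>0
  ratio-mono-≤ {p} {suc q} {c} {suc d} (s≤s z≤n) (s≤s z≤n) pd≤cq = toℚᵘ-cancel-≤
    (ℚᵘ.≤-respˡ-≃ (ℚᵘ.≃-sym (toℚᵘ-ratio p q)) (ℚᵘ.≤-respʳ-≃ (ℚᵘ.≃-sym (toℚᵘ-ratio c d))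
      (*≤* (subst₂ ℤ._≤_ (ℤ.pos-* p (suc d)) (ℤ.pos-* c (suc q)) (ℤ.+≤+ pd≤cq)))))

  1+n[1-1/m]≡ratio : ∀ {m′ n} → 1 ≤ m′ → 1 ≤ n →
    1ℚ + ratio n 1 (s≤s z≤n) * (1ℚ - ratio 1 (suc m′) (s≤s z≤n))
      ≡ ratio (suc m′ ℕ.+ m′ ℕ.* n) (suc m′) (s≤s z≤n)
  1+n[1-1/m]≡ratio {m′@(suc a)} {n@(suc b)} (s≤s z≤n) (s≤s z≤n) = toℚᵘ-injective (begin
    toℚᵘ (1ℚ + N * (1ℚ - M))
      ≈⟨ toℚᵘ-homo-+ 1ℚ (N * (1ℚ - M)) ⟩
    1ℚᵘ ℚᵘ.+ toℚᵘ (N * (1ℚ - M))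
      ≈⟨ ℚᵘ.+-congʳ 1ℚᵘ (toℚᵘ-homo-* N (1ℚ - M)) ⟩
    1ℚᵘ ℚᵘ.+ toℚᵘ N ℚᵘ.* toℚᵘ (1ℚ - M)
      ≈⟨ ℚᵘ.+-congʳ 1ℚᵘ (ℚᵘ.*-congˡ {toℚᵘ N} (toℚᵘ-homo-+ 1ℚ (- M))) ⟩
    1ℚᵘ ℚᵘ.+ toℚᵘ N ℚᵘ.* (1ℚᵘ ℚᵘ.+ toℚᵘ (- M))
      ≈⟨ ℚᵘ.+-congʳ 1ℚᵘ (ℚᵘ.*-congˡ {toℚᵘ N} (ℚᵘ.+-congʳ 1ℚᵘ (toℚᵘ-homo‿- M))) ⟩
    1ℚᵘ ℚᵘ.+ toℚᵘ N ℚᵘ.* (1ℚᵘ ℚᵘ.- toℚᵘ M)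
      ≈⟨ ℚᵘ.+-congʳ 1ℚᵘ (ℚᵘ.*-cong (toℚᵘ-ratio n 0) (ℚᵘ.+-congʳ 1ℚᵘ (ℚᵘ.-‿cong (toℚᵘ-ratio 1 m′)))) ⟩
    1ℚᵘ ℚᵘ.+ mkℚᵘ (+ n) 0 ℚᵘ.* (1ℚᵘ ℚᵘ.- mkℚᵘ (+ 1) m′)
      ≈⟨ *≡* (cong +_ (ℕ-Solver.solve (a ∷ b ∷ []))) ⟩
    mkℚᵘ (+ (suc m′ ℕ.+ m′ ℕ.* n)) m′
      ≈⟨ toℚᵘ-ratio (suc m′ ℕ.+ m′ ℕ.* n) m′ ⟨
    toℚᵘ (ratio (suc m′ ℕ.+ m′ ℕ.* n) (suc m′) (s≤s z≤n))
      ∎)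
    where
    open ℚᵘ.≃-Reasoning
    N = ratio n 1 (s≤s z≤n)
    M = ratio 1 (suc m′) (s≤s z≤n)

open UpperBound using (domColouring-bound)
open RatioArithmetic using (ratio-mono-≤; 1+n[1-1/m]≡ratio)

proposition6 : (m n : ℕ) → (2≤n : 2 ≤ n) → (n≤m : n ≤ m) →
    IsFdom (K m n) (1ℚ + ratio n 1 ((s≤s z≤n)) * (1ℚ - ratio 1 m (pos 2≤n n≤m)))
proposition6 ℕ.zero       n (s≤s (s≤s z≤n)) ()
proposition6 m@(ℕ.suc m′) n 2≤n              n≤m =
    ( c ℕ.+ n ℕ.* m , m , s≤s z≤n , m≤#colours , domColouring
    , trans (cong (λ P → ratio P m (s≤s z≤n)) #colours) (sym value))
  , λ p q q>0 _ D → subst (ratio p q q>0 ≤ℚ_) (sym value) (bound q>0 D)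
  where
  c : ℕ
  c = m ℕ.∸ n

  open Construction m′ n c (m∸n+n≡m n≤m) using (domColouring; #colours)

  1≤m′ : 1 ≤ m′
  1≤m′ = ≤-pred (≤-trans 2≤n n≤m)

  value : 1ℚ + ratio n 1 (s≤s z≤n) * (1ℚ - ratio 1 m (s≤s z≤n))
          ≡ ratio (m ℕ.+ m′ ℕ.* n) m (s≤s z≤n)
  value = 1+n[1-1/m]≡ratio 1≤m′ (≤-trans (s≤s z≤n) 2≤n)

  bound : ∀ {p q} (q>0 : 0 ℕ.< q) → DomColouring (K m n) p q →
          ratio p q q>0 ≤ℚ ratio (m ℕ.+ m′ ℕ.* n) m (s≤s z≤n)
  bound {p} {q} q>0 D =
    ratio-mono-≤ {p} {q} {m ℕ.+ m′ ℕ.* n} {m} q>0 (s≤s z≤n) (domColouring-bound 1≤m′ 2≤n D)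

  m≤#colours : m ≤ c ℕ.+ n ℕ.* m
  m≤#colours = subst (m ≤_) (sym #colours) (m≤m+n m (m′ ℕ.* n))
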